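{- Let $Q'\subseteq[n]\times[n]$ be a set of query points and let $G$ be a grid with width $\mu$ and height $n^2/(\beta^i\mu)$ for some parameter $n/\beta^i\le\mu\le n$. Let $h$ denote the hitting number of $Q'$ on $G$. Then there is a subset $Q\subseteq Q'$ with $|Q|=\Omega(h-6n/\mu-6\mu\beta^i/n)$ such that $\{\mathrm{inc}_i(q):q\in Q\}$ is a linearly independent set of vectors in $[\Delta]^{\beta^i}$.
   Context: $\beta>1$, $i\ge1$, and $\beta^i=f_{k_i}$ is a Fibonacci number dividing $n$; $\Delta$ is a prime. The scaled Fibonacci lattice of epoch $i$ consists of the points $P_j=\big(\tfrac{n}{\beta^i}j,\ \tfrac{n}{\beta^i}(jf_{k_i-1}\bmod\beta^i)\big)$, $j=0,\dots,\beta^i-1$. For $q=(x,y)$, the incidence vector $\mathrm{inc}_i(q)\in\{0,1\}^{\beta^i}\subseteq[\Delta]^{\beta^i}$ has $j$-th coordinate $1$ iff $P_j$ is dominated by $q$ (both coordinates of $P_j$ at most those of $q$), else $0$; linear independence is over $\mathbb{Z}/\Delta\mathbb{Z}$. A grid with width $\mu\ge1$ and height $\gamma\ge1$ is the collection of grid cells $[j\mu,(j+1)\mu)\times[h\gamma,(h+1)\gamma)$ for $0\le j<n/\mu$, $0\le h<n/\gamma$. A query point hits a grid cell if it lies in it; the hitting number of a query set on a grid is the number of distinct grid cells hit by some query of the set. -}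

module Defs where

open import Data.Nat using (ℕ; zero; suc; _+_; _*_; _∸_; _≤_; _<_; _≤?_)
open import Data.Nat.DivMod using (_/_; _%_)
open import Data.Nat.Divisibility using (_∣_)
open import Data.Nat.Properties using (_≟_)
open import Data.Bool using (if_then_else_; _∧_)
open import Data.Product using (_×_; _,_)
open import Data.Product.Properties using (≡-dec)
open import Data.List using (List; []; _∷_; length; map; zipWith; deduplicate)
open import Data.Nat.ListAction using (sum)
open import Data.List.Relation.Unary.All using (All)
open import Relation.Nullary using (does)

fib : ℕ → ℕ
fib zero = 0
fib (suc zero) = 1
fib (suc (suc k)) = fib (suc k) + fib k

-- total division / remainder (the divisor is always nonzero where used)
divℕ : ℕ → ℕ → ℕ
divℕ x zero = 0
divℕ x (suc d) = x / suc d

modℕ : ℕ → ℕ → ℕ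
modℕ x zero = x
modℕ x (suc d) = x % suc d

Point : Set
Point = ℕ × ℕ

-- q ∈ [n] × [n], with [n] = {0,…,n-1}
InRange : ℕ → Point → Set
InRange n (x , y) = x < n × y < n

-- P_j of the scaled Fibonacci lattice with m = β^i = f_k points:
-- P_j = ((n/m) j , (n/m) (j f_{k-1} mod m))
latticePt : (n m k j : ℕ) → Point
latticePt n m k j = (divℕ n m * j , divℕ n m * modℕ (j * fib (k ∸ 1)) m)

domInd : Point → Point → ℕ
domInd (a , b) (x , y) = if does (a ≤? x) ∧ does (b ≤? y) then 1 else 0

-- inc_i(q), j-th coordinate (meaningful for j < m)
inc : (n m k : ℕ) → Point → ℕ → ℕ
inc n m k q j = domInd (latticePt n m k j) q

linComb : List ℕ → List (ℕ → ℕ) → ℕ → ℕ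
linComb cs vs j = sum (zipWith (λ c v → c * v j) cs vs)

-- the family vs of vectors in (ℤ/Δℤ)^d is linearly independent
LinIndep : (Δ d : ℕ) → List (ℕ → ℕ) → Set
LinIndep Δ d vs =
  (cs : List ℕ) → length cs ≡ length vs →
  ((j : ℕ) → j < d → Δ ∣ linComb cs vs j) → All (Δ ∣_) cs
  where open import Relation.Binary.PropositionalEquality using (_≡_)

-- grid cell of width μ and height γ = γn / γd containing (x , y):
-- (⌊x / μ⌋ , ⌊y / γ⌋) = (⌊x / μ⌋ , ⌊y γd / γn⌋)
gridCell : (μ γn γd : ℕ) → Point → Point
gridCell μ γn γd (x , y) = (divℕ x μ , divℕ (y * γd) γn)

hittingNumber : (μ γn γd : ℕ) → List Point → ℕ
hittingNumber μ γn γd qs = length (deduplicate (≡-dec _≟_ _≟_) (map (gridCell μ γn γd) qs))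

module Submission where

open import Defs

-- 1. Fibonacci lattice. {(j , j f(k−1) mod f(k))} is the integer lattice
--    y ≡ x f(k−1) (mod f(k)); for k = e + u + 2 with e even, d'Ocagne's identities give
--    it the basis (f(e+1), f(u+1)), (f(e+2), −f(u)) of area f(k), so it meets every box
--    of size f(e+3) × f(u+2); choosing e, u, it meets every box of area > 9 f(k).
-- 2. Grid. Below a query q in a cell of column ≥ 4 and row ≥ 4, four columns × four
--    rows of cells span a lattice box of area > 9m; its lattice point P_j is dominated by
--    q, and every point dominating P_j lies at most four cells left of and below q's cell.
-- 3. Selection. The hit cells in the first four columns or rows are few (≤ (6n² + 6μ²m)/μn);
--    among the others pick a residue class mod (5 , 5) holding 1/25 of them and one query
--    per cell. In decreasing lexicographic order of cells no later query dominates an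
--    earlier pivot (it would force the cells to coincide), so the vectors are triangular.

module Fibonacci where

  open import Data.Nat using (ℕ; zero; suc; _+_; _*_; _∸_; _≤_; _<_; z≤n; s≤s)
  open import Data.Nat.Properties
  open import Data.Product using (∃; _×_; _,_)
  open import Data.Sum using (inj₁; inj₂)
  open import Relation.Binary.PropositionalEquality
  import Data.Nat.Tactic.RingSolver as ℕ-Ring

  fib-pos : ∀ n → 1 ≤ fib (suc n)
  fib-pos zero    = s≤s z≤n
  fib-pos (suc n) = ≤-trans (fib-pos n) (m≤m+n (fib (suc n)) (fib n))

  fib-mono : ∀ {m n} → m ≤ n → fib m ≤ fib n
  fib-mono {n = zero}  z≤n = z≤n
  fib-mono {n = suc n} m≤1+n with m≤n⇒m<n∨m≡n m≤1+n
  ... | inj₂ refl      = ≤-refl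
  ... | inj₁ (s≤s m≤n) = ≤-trans (fib-mono m≤n) (fib-step n)
    where
    fib-step : ∀ n → fib n ≤ fib (suc n)
    fib-step zero    = z≤n
    fib-step (suc n) = m≤m+n (fib (suc n)) (fib n)

  fib-<-2 : ∀ n → fib (1 + n) < fib (3 + n)
  fib-<-2 n = +-monoˡ-< (fib (1 + n)) (fib-pos (1 + n))

  fib-add : ∀ e u → fib (2 + e + u) ≡ fib u * fib (1 + e) + fib (1 + u) * fib (2 + e)
  fib-add zero          u = base₀ (fib (1 + u)) (fib u)
    where
    base₀ : ∀ a b → a + b ≡ b * 1 + a * 1
    base₀ = ℕ-Ring.solve-∀
  fib-add (suc zero)    u = base₁ (fib (1 + u)) (fib u)
    where
    base₁ : ∀ a b → a + b + a ≡ b * 1 + a * 2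
    base₁ = ℕ-Ring.solve-∀
  fib-add (suc (suc e)) u = begin
    fib (3 + e + u) + fib (2 + e + u)
      ≡⟨ cong₂ _+_ (fib-add (suc e) u) (fib-add e u) ⟩
    (fib u * fib (2 + e) + fib (1 + u) * fib (3 + e)) + (fib u * fib (1 + e) + fib (1 + u) * fib (2 + e))
      ≡⟨ regroup (fib u) (fib (1 + u)) (fib (1 + e)) (fib (2 + e)) ⟩
    fib u * fib (3 + e) + fib (1 + u) * fib (4 + e) ∎
    where
    open ≡-Reasoning
    regroup : ∀ x y p q → (x * q + y * (q + p)) + (x * p + y * q) ≡ x * (q + p) + y * ((q + p) + q)
    regroup = ℕ-Ring.solve-∀

  -- Growth bound f(N+6) = 8 f(N+1) + 5 f(N) ≤ 9 f(N+2).
  fib-6≤9 : ∀ N → fib (6 + N) ≤ 9 * fib (2 + N)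
  fib-6≤9 N = begin
    fib (6 + N)                 ≡⟨ unfold (fib (1 + N)) (fib N) ⟩
    8 * fib (1 + N) + 5 * fib N ≤⟨ +-mono-≤ (*-monoˡ-≤ (fib (1 + N)) (n≤1+n 8)) (*-monoˡ-≤ (fib N) (m≤m+n 5 4)) ⟩
    9 * fib (1 + N) + 9 * fib N ≡⟨ *-distribˡ-+ 9 (fib (1 + N)) (fib N) ⟨
    9 * fib (2 + N)             ∎
    where
    open ≤-Reasoning
    unfold : ∀ p q → (((p + q) + p) + (p + q)) + ((p + q) + p) + (((p + q) + p) + (p + q)) ≡ 8 * p + 5 * q
    unfold = ℕ-Ring.solve-∀

  fibY : ℕ → ℕ → ℕ
  fibY k j = modℕ (j * fib (k ∸ 1)) (fib k)

  HitsBox : (k X W Y H : ℕ) → Set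
  HitsBox k X W Y H = ∃ λ j → X ≤ j × j < X + W × Y ≤ fibY k j × fibY k j < Y + H

module FibonacciLattice where

  open Fibonacci
  open import Data.Nat as ℕ using (ℕ; zero; suc; NonZero)
  import Data.Nat.Properties as ℕP
  open import Data.Integer using (ℤ; +_; -[1+_]; _+_; _*_; _-_; -_)
  open import Data.Integer.Properties using (pos-+; pos-*; +-injective; neg-involutive)
  open import Data.Integer.DivMod using (_/ℕ_; _%ℕ_; a≡a%ℕn+[a/ℕn]*n; n%ℕd<d)
  open import Data.Integer.Tactic.RingSolver using (solve-∀)
  open import Data.Product using (∃; ∃₂; _×_; _,_; proj₁; proj₂)
  open import Data.Nat.DivMod using (_%_; m<n⇒m%n≡m; [m+kn]%n≡m%n)
  open import Relation.Binary.PropositionalEquality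
  open ≡-Reasoning

  F : ℕ → ℤ
  F n = + fib n

  F-rec : ∀ n → F (suc (suc n)) ≡ F (suc n) + F n
  F-rec n = pos-+ (fib (suc n)) (fib n)

  -- double w = 2 w, by recursion so that d'Ocagne's identities go by induction on w.
  double : ℕ → ℕ
  double zero    = zero
  double (suc w) = suc (suc (double w))

  D : ℕ → ℕ → ℤ
  D s t = F (suc s) * F (suc t) - F s * F (suc (suc t))

  D-step : ∀ s t → D (suc s) (suc t) ≡ - D s t
  D-step s t = begin
    F (suc (suc s)) * F (suc (suc t)) - F (suc s) * F (suc (suc (suc t)))
      ≡⟨ cong₂ (λ p q → p * F (suc (suc t)) - F (suc s) * q) (F-rec s) (F-rec (suc t)) ⟩
    (F (suc s) + F s) * F (suc (suc t)) - F (suc s) * (F (suc (suc t)) + F (suc t))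
      ≡⟨ expand (F (suc s)) (F s) (F (suc (suc t))) (F (suc t)) ⟩
    - D s t ∎
    where
    expand : ∀ a b c d → (a + b) * c - a * (c + d) ≡ - (a * d - b * c)
    expand = solve-∀


  D-step² : ∀ s t → D (suc (suc s)) (suc (suc t)) ≡ D s t
  D-step² s t = trans (D-step (suc s) (suc t)) (trans (cong -_ (D-step s t)) (neg-involutive (D s t)))

  d'Ocagne : ∀ w u → D (double w) (double w ℕ.+ u) ≡ F (suc u)
  d'Ocagne zero    u = base (F (suc u)) (F (suc (suc u)))
    where
    base : ∀ x y → + 1 * x - + 0 * y ≡ x
    base = solve-∀
  d'Ocagne (suc w) u = trans (D-step² (double w) (double w ℕ.+ u)) (d'Ocagne w u)

  d'Ocagne′ : ∀ w u → D (suc (double w)) (double w ℕ.+ u) ≡ - F u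
  d'Ocagne′ zero    u = trans (cong (λ z → + 1 * F (suc u) - + 1 * z) (F-rec u)) (base (F (suc u)) (F u))
    where
    base : ∀ x y → + 1 * x - + 1 * (x + y) ≡ - y
    base = solve-∀
  d'Ocagne′ (suc w) u = trans (D-step² (suc (double w)) (double w ℕ.+ u)) (d'Ocagne′ w u)

  _∈Λ[_,_] : ℤ × ℤ → ℤ → ℤ → Set
  (x , y) ∈Λ[ a , M ] = ∃ λ c → y ≡ x * a + c * M

  -- A point p of Λ(a, M) in the half-open parallelogram t + [0,1) v₁ + [0,1) v₂,
  -- recorded as M (p − t) = r₁ v₁ + r₂ v₂ with 0 ≤ r₁ , r₂ < M.
  record ParallelogramPoint (a : ℤ) (M : ℕ) (v₁ v₂ t : ℤ × ℤ) : Set where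
    field
      point    : ℤ × ℤ
      r₁ r₂    : ℕ
      r₁<M     : r₁ ℕ.< M
      r₂<M     : r₂ ℕ.< M
      offsetX  : + M * (proj₁ point - proj₁ t) ≡ + r₁ * proj₁ v₁ + + r₂ * proj₁ v₂
      offsetY  : + M * (proj₂ point - proj₂ t) ≡ + r₁ * proj₂ v₁ + + r₂ * proj₂ v₂
      onLattice : point ∈Λ[ a , + M ]

  -- If v₁ , v₂ ∈ Λ(a, M) span a parallelogram of area M, every translate of that
  -- (half-open) parallelogram contains a point of Λ(a, M): write M t in the basis
  -- v₁ , v₂ by Cramer's rule and divide the coefficients by M with remainder.
  parallelogram : ∀ a M .{{_ : NonZero M}} x₁ y₁ x₂ y₂ →
    (x₁ , y₁) ∈Λ[ a , + M ] → (x₂ , y₂) ∈Λ[ a , + M ] → + M ≡ x₂ * y₁ - x₁ * y₂ →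
    ∀ t → ParallelogramPoint a M (x₁ , y₁) (x₂ , y₂) t
  parallelogram a M x₁ y₁ x₂ y₂ (c₁ , y₁≡) (c₂ , y₂≡) area (x₀ , y₀) = record
    { point = px , py ; r₁ = r₁ ; r₂ = r₂ ; r₁<M = n%ℕd<d L₁ M ; r₂<M = n%ℕd<d L₂ M
    ; offsetX = offset px x₀ x₁ x₂ (cramerX x₀ y₀ x₁ y₁ x₂ y₂ q₁ q₂)
    ; offsetY = offset py y₀ y₁ y₂ (cramerY x₀ y₀ x₁ y₁ x₂ y₂ q₁ q₂)
    ; onLattice = - (q₁ * c₁ + q₂ * c₂) , lattice }
    where
    L₁ L₂ q₁ q₂ px py : ℤ
    L₁ = x₀ * y₂ - y₀ * x₂
    L₂ = y₀ * x₁ - x₀ * y₁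
    q₁ = L₁ /ℕ M
    q₂ = L₂ /ℕ M
    r₁ r₂ : ℕ
    r₁ = L₁ %ℕ M
    r₂ = L₂ %ℕ M
    px = - (q₁ * x₁ + q₂ * x₂)
    py = - (q₁ * y₁ + q₂ * y₂)
    Δ : ℤ
    Δ = x₂ * y₁ - x₁ * y₂

    -- Cramer's rule: Δ t = −(L₁ v₁ + L₂ v₂), so Δ (p − t) = (L₁ − q₁ Δ) v₁ + (L₂ − q₂ Δ) v₂.
    cramerX : ∀ x₀ y₀ x₁ y₁ x₂ y₂ q₁ q₂ →
      (x₂ * y₁ - x₁ * y₂) * (- (q₁ * x₁ + q₂ * x₂) - x₀)
        ≡ ((x₀ * y₂ - y₀ * x₂) - q₁ * (x₂ * y₁ - x₁ * y₂)) * x₁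
          + ((y₀ * x₁ - x₀ * y₁) - q₂ * (x₂ * y₁ - x₁ * y₂)) * x₂
    cramerX = solve-∀
    cramerY : ∀ x₀ y₀ x₁ y₁ x₂ y₂ q₁ q₂ →
      (x₂ * y₁ - x₁ * y₂) * (- (q₁ * y₁ + q₂ * y₂) - y₀)
        ≡ ((x₀ * y₂ - y₀ * x₂) - q₁ * (x₂ * y₁ - x₁ * y₂)) * y₁
          + ((y₀ * x₁ - x₀ * y₁) - q₂ * (x₂ * y₁ - x₁ * y₂)) * y₂
    cramerY = solve-∀

    remainder : ∀ L → L - (L /ℕ M) * Δ ≡ + (L %ℕ M)
    remainder L = begin
      L - (L /ℕ M) * Δ   ≡⟨ cong (λ m → L - (L /ℕ M) * m) area ⟨
      L - (L /ℕ M) * + M ≡⟨ cong (λ l → l - (L /ℕ M) * + M) (a≡a%ℕn+[a/ℕn]*n L M) ⟩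
      + (L %ℕ M) + (L /ℕ M) * + M - (L /ℕ M) * + M ≡⟨ cancel (+ (L %ℕ M)) ((L /ℕ M) * + M) ⟩
      + (L %ℕ M) ∎
      where
      cancel : ∀ r s → r + s - s ≡ r
      cancel = solve-∀

    offset : ∀ p z₀ z₁ z₂ → Δ * (p - z₀) ≡ (L₁ - q₁ * Δ) * z₁ + (L₂ - q₂ * Δ) * z₂ →
             + M * (p - z₀) ≡ + r₁ * z₁ + + r₂ * z₂
    offset p z₀ z₁ z₂ eq = begin
      + M * (p - z₀)                              ≡⟨ cong (_* (p - z₀)) area ⟩
      Δ * (p - z₀)                                ≡⟨ eq ⟩
      (L₁ - q₁ * Δ) * z₁ + (L₂ - q₂ * Δ) * z₂      ≡⟨ cong₂ (λ u v → u * z₁ + v * z₂) (remainder L₁) (remainder L₂) ⟩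
      + r₁ * z₁ + + r₂ * z₂ ∎

    lattice : py ≡ px * a + - (q₁ * c₁ + q₂ * c₂) * + M
    lattice = begin
      - (q₁ * y₁ + q₂ * y₂)  ≡⟨ cong₂ (λ u v → - (q₁ * u + q₂ * v)) y₁≡ y₂≡ ⟩
      - (q₁ * (x₁ * a + c₁ * + M) + q₂ * (x₂ * a + c₂ * + M)) ≡⟨ regroup q₁ q₂ x₁ x₂ a c₁ c₂ (+ M) ⟩
      px * a + - (q₁ * c₁ + q₂ * c₂) * + M ∎
      where
      regroup : ∀ q₁ q₂ x₁ x₂ a c₁ c₂ m → - (q₁ * (x₁ * a + c₁ * m) + q₂ * (x₂ * a + c₂ * m))
                  ≡ - (q₁ * x₁ + q₂ * x₂) * a + - (q₁ * c₁ + q₂ * c₂) * m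
      regroup = solve-∀

  private
    quotient-bound : ∀ M d r₁ f r₂ g → 1 ℕ.≤ f → r₁ ℕ.< M → r₂ ℕ.≤ M →
                     M ℕ.* d ≡ r₁ ℕ.* f ℕ.+ r₂ ℕ.* g → d ℕ.< f ℕ.+ g
    quotient-bound M d r₁ f r₂ g f>0 r₁<M r₂≤M eq = ℕP.*-cancelˡ-< M d (f ℕ.+ g)
      (subst₂ ℕ._<_ (sym eq) (sym (ℕP.*-distribˡ-+ M f g))
        (ℕP.+-mono-<-≤ (ℕP.*-monoˡ-< f {{ℕ.>-nonZero f>0}} r₁<M) (ℕP.*-monoˡ-≤ g r₂≤M)))

    natural-quotient : ∀ M .{{_ : NonZero M}} D N → + M * D ≡ + N → ∃ λ d → D ≡ + d × M ℕ.* d ≡ N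
    natural-quotient (suc m) (+ d) N eq = d , refl , +-injective (trans (pos-* (suc m) d) eq)

    pos-+* : ∀ a b c d → + a * + b + + c * + d ≡ + (a ℕ.* b ℕ.+ c ℕ.* d)
    pos-+* a b c d = sym (trans (pos-+ (a ℕ.* b) (c ℕ.* d)) (cong₂ _+_ (pos-* a b) (pos-* c d)))

    -- Moving the target down by y₂ turns M (p − (Y + y₂)) = r₁ y₁ − r₂ y₂ into the
    -- nonnegative M (p − Y) = r₁ y₁ + (M − r₂) y₂.
    shiftDown : ∀ M r₁ r₂ y₁ y₂ p Y → r₂ ℕ.≤ M →
      + M * (p - + (Y ℕ.+ y₂)) ≡ + r₁ * + y₁ + + r₂ * - + y₂ →
      + M * (p - + Y) ≡ + (r₁ ℕ.* y₁ ℕ.+ (M ℕ.∸ r₂) ℕ.* y₂)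
    shiftDown M r₁ r₂ y₁ y₂ p Y r₂≤M eq = begin
      + M * (p - + Y)
        ≡⟨ cong (λ m → m * (p - + Y)) M≡ ⟩
      (+ r₂ + + (M ℕ.∸ r₂)) * (p - + Y)
        ≡⟨ split (+ r₂) (+ (M ℕ.∸ r₂)) p (+ Y) (+ y₂) ⟩
      (+ r₂ + + (M ℕ.∸ r₂)) * (p - (+ Y + + y₂)) + (+ r₂ + + (M ℕ.∸ r₂)) * + y₂
        ≡⟨ cong₂ (λ m z → m * (p - z) + (+ r₂ + + (M ℕ.∸ r₂)) * + y₂) (sym M≡) (sym (pos-+ Y y₂)) ⟩
      + M * (p - + (Y ℕ.+ y₂)) + (+ r₂ + + (M ℕ.∸ r₂)) * + y₂
        ≡⟨ cong (_+ (+ r₂ + + (M ℕ.∸ r₂)) * + y₂) eq ⟩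
      + r₁ * + y₁ + + r₂ * - + y₂ + (+ r₂ + + (M ℕ.∸ r₂)) * + y₂
        ≡⟨ merge (+ r₁) (+ y₁) (+ r₂) (+ (M ℕ.∸ r₂)) (+ y₂) ⟩
      + r₁ * + y₁ + + (M ℕ.∸ r₂) * + y₂
        ≡⟨ pos-+* r₁ y₁ (M ℕ.∸ r₂) y₂ ⟩
      + (r₁ ℕ.* y₁ ℕ.+ (M ℕ.∸ r₂) ℕ.* y₂) ∎
      where
      M≡ : + M ≡ + r₂ + + (M ℕ.∸ r₂)
      M≡ = trans (cong +_ (sym (ℕP.m+[n∸m]≡n r₂≤M))) (pos-+ r₂ (M ℕ.∸ r₂))
      split : ∀ r s p y h → (r + s) * (p - y) ≡ (r + s) * (p - (y + h)) + (r + s) * h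
      split = solve-∀
      merge : ∀ r₁ y₁ r₂ s y₂ → r₁ * y₁ + r₂ * - y₂ + (r₂ + s) * y₂ ≡ r₁ * y₁ + s * y₂
      merge = solve-∀

    unshift : ∀ p Z d → p - + Z ≡ + d → p ≡ + (Z ℕ.+ d)
    unshift p Z d eq = trans (back p (+ Z)) (trans (cong (λ z → + Z + z) eq) (sym (pos-+ Z d)))
      where
      back : ∀ p z → p ≡ z + (p - z)
      back = solve-∀

  -- If Λ(a, M) has the basis v₁ = (x₁ , y₁), v₂ = (x₂ , −y₂) with x₁ , y₁ > 0 and
  -- x₂ , y₂ ≥ 0, every box [X , X + x₁ + x₂) × [Y , Y + y₁ + y₂) of ℕ² contains a
  -- point of Λ(a, M): apply `parallelogram` to the target (X , Y + y₂).
  boxPoint : ∀ a M .{{_ : NonZero M}} x₁ y₁ x₂ y₂ → 1 ℕ.≤ x₁ → 1 ℕ.≤ y₁ →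
    (+ x₁ , + y₁) ∈Λ[ + a , + M ] → (+ x₂ , - + y₂) ∈Λ[ + a , + M ] →
    M ≡ x₂ ℕ.* y₁ ℕ.+ x₁ ℕ.* y₂ → ∀ X Y →
    ∃₂ λ dX dY → dX ℕ.< x₁ ℕ.+ x₂ × dY ℕ.< y₁ ℕ.+ y₂ × (+ (X ℕ.+ dX) , + (Y ℕ.+ dY)) ∈Λ[ + a , + M ]
  boxPoint a M x₁ y₁ x₂ y₂ x₁>0 y₁>0 v₁∈Λ v₂∈Λ area X Y =
    let open ParallelogramPoint (parallelogram (+ a) M (+ x₁) (+ y₁) (+ x₂) (- + y₂) v₁∈Λ v₂∈Λ area′ (+ X , + (Y ℕ.+ y₂)))
        c , onΛ        = onLattice
        dX , px≡ , MdX = natural-quotient M (proj₁ point - + X) _ (trans offsetX (pos-+* r₁ x₁ r₂ x₂))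
        dY , py≡ , MdY = natural-quotient M (proj₂ point - + Y) _ (shiftDown M r₁ r₂ y₁ y₂ (proj₂ point) Y (ℕP.<⇒≤ r₂<M) offsetY)
    in dX , dY , quotient-bound M dX r₁ x₁ r₂ x₂ x₁>0 r₁<M (ℕP.<⇒≤ r₂<M) MdX ,
       quotient-bound M dY r₁ y₁ (M ℕ.∸ r₂) y₂ y₁>0 r₁<M (ℕP.m∸n≤m M r₂) MdY ,
       c , subst₂ (λ p q → q ≡ p * + a + c * + M) (unshift (proj₁ point) X dX px≡) (unshift (proj₂ point) Y dY py≡) onΛ
    where
    area′ : + M ≡ + x₂ * + y₁ - + x₁ * - + y₂
    area′ = trans (cong +_ area) (trans (sym (pos-+* x₂ y₁ x₁ y₂)) (flip-sign (+ x₂) (+ y₁) (+ x₁) (+ y₂)))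
      where
      flip-sign : ∀ a b c d → a * b + c * d ≡ a * b - c * - d
      flip-sign = solve-∀

  ∈Λ⇒mod : ∀ x y a M .{{_ : NonZero M}} → (+ x , + y) ∈Λ[ + a , + M ] → y ℕ.< M → (x ℕ.* a) % M ≡ y
  ∈Λ⇒mod x y a M (+ c , eq) y<M = begin
    (x ℕ.* a) % M               ≡⟨ [m+kn]%n≡m%n (x ℕ.* a) c M ⟨
    (x ℕ.* a ℕ.+ c ℕ.* M) % M   ≡⟨ cong (_% M) (+-injective (trans eq (pos-+* x a c M))) ⟨
    y % M                       ≡⟨ m<n⇒m%n≡m y<M ⟩
    y ∎
  ∈Λ⇒mod x y a M (-[1+ c ] , eq) y<M = begin
    (x ℕ.* a) % M                 ≡⟨ cong (_% M) (+-injective (trans (pos-* x a) (trans (solve-x (+ x * + a) (+ y) -[1+ c ] (+ M) eq) (pos-+* y 1 (suc c) M)))) ⟩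
    (y ℕ.* 1 ℕ.+ suc c ℕ.* M) % M ≡⟨ [m+kn]%n≡m%n (y ℕ.* 1) (suc c) M ⟩
    (y ℕ.* 1) % M                 ≡⟨ cong (_% M) (ℕP.*-identityʳ y) ⟩
    y % M                         ≡⟨ m<n⇒m%n≡m y<M ⟩
    y ∎
    where
    solve-x : ∀ p y c m → y ≡ p + c * m → p ≡ y * + 1 + (- c) * m
    solve-x p y c m eq = trans (rearrange p c m) (cong (λ z → z * + 1 + (- c) * m) (sym eq))
      where
      rearrange : ∀ p c m → p ≡ (p + c * m) * + 1 + (- c) * m
      rearrange = solve-∀

  modℕ≡% : ∀ x M .{{_ : NonZero M}} → modℕ x M ≡ x % M
  modℕ≡% x (suc M) = refl

  -- For k = e + u + 2 with e even, the Fibonacci lattice {(j , j f(k−1) mod f(k))} is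
  -- Λ(f(k−1), f(k)) ∩ [0 , f(k))², which has the basis (f(e+1) , f(u+1)), (f(e+2) , −f(u))
  -- of area f(k) by d'Ocagne's identities and the addition formula. Hence it meets
  -- every box of size f(e+3) × f(u+2) lying below height f(k).
  fibonacciBox : ∀ w u X Y → let e = double w in
    Y ℕ.+ fib (suc (suc u)) ℕ.≤ fib (suc (suc (e ℕ.+ u))) →
    HitsBox (suc (suc (e ℕ.+ u))) X (fib (suc (suc (suc e)))) Y (fib (suc (suc u)))
  fibonacciBox w u X Y below =
    let dX , dY , dX< , dY< , onΛ = boxPoint (fib (suc (e ℕ.+ u))) M (fib (suc e)) (fib (suc u)) (fib (suc (suc e))) (fib u)
                                      (fib-pos e) (fib-pos u) v₁∈Λ v₂∈Λ area X Y
        height : fibY (suc (suc (e ℕ.+ u))) (X ℕ.+ dX) ≡ Y ℕ.+ dY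
        height = trans (modℕ≡% _ M) (∈Λ⇒mod (X ℕ.+ dX) (Y ℕ.+ dY) _ M onΛ (ℕP.<-≤-trans (ℕP.+-monoʳ-< Y dY<) below))
    in X ℕ.+ dX , ℕP.m≤m+n X dX , ℕP.+-monoʳ-< X (subst (dX ℕ.<_) (ℕP.+-comm (fib (suc e)) (fib (suc (suc e)))) dX<) ,
       subst (Y ℕ.≤_) (sym height) (ℕP.m≤m+n Y dY) , subst (ℕ._< Y ℕ.+ fib (suc (suc u))) (sym height) (ℕP.+-monoʳ-< Y dY<)
    where
    e M : ℕ
    e = double w
    M = fib (suc (suc (e ℕ.+ u)))
    instance
      M≢0 : NonZero M
      M≢0 = ℕ.>-nonZero (fib-pos (suc (e ℕ.+ u)))
    solve-y : ∀ p q m y → p - q * m ≡ y → y ≡ p + (- q) * m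
    solve-y p q m y eq = trans (sym eq) (negate-right p q m)
      where
      negate-right : ∀ p q m → p - q * m ≡ p + (- q) * m
      negate-right = solve-∀
    v₁∈Λ : (+ fib (suc e) , + fib (suc u)) ∈Λ[ F (suc (e ℕ.+ u)) , + M ]
    v₁∈Λ = - F e , solve-y (F (suc e) * F (suc (e ℕ.+ u))) (F e) (+ M) (F (suc u)) (d'Ocagne w u)
    v₂∈Λ : (+ fib (suc (suc e)) , - + fib u) ∈Λ[ F (suc (e ℕ.+ u)) , + M ]
    v₂∈Λ = - F (suc e) , solve-y (F (suc (suc e)) * F (suc (e ℕ.+ u))) (F (suc e)) (+ M) (- F u) (d'Ocagne′ w u)
    area : M ≡ fib (suc (suc e)) ℕ.* fib (suc u) ℕ.+ fib (suc e) ℕ.* fib u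
    area = trans (fib-add e u) (trans (ℕP.+-comm (fib u ℕ.* fib (suc e)) _)
             (cong₂ ℕ._+_ (ℕP.*-comm (fib (suc u)) (fib (suc (suc e)))) (ℕP.*-comm (fib u) (fib (suc e)))))

open import Data.Nat using (ℕ; zero; suc; _+_; _*_; _∸_; _^_; _≤_; _<_; z≤n; s≤s; s≤s⁻¹; _≤?_; _<?_; _≤ᵇ_; NonZero; >-nonZero)
open import Data.Nat.Properties
open import Data.Nat.DivMod using (_/_; _%_; m≡m%n+[m/n]*n; m%n<n; m/n*n≤m; m*n/n≡m; m/n*n≡m; /-monoˡ-≤)
open import Data.Nat.Divisibility using (_∣_; ∣m+n∣m⇒∣n; ∣m⇒∣m*n)
open import Data.Nat.Primality using (Prime)
open import Data.Nat.ListAction using (sum)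
import Data.Nat.Tactic.RingSolver as ℕ-Ring
open import Data.Bool using (true; false; if_then_else_; _∧_; T)
open import Data.Unit using (tt)
open import Data.Sum using (inj₁; inj₂)
open import Data.Product using (∃; ∃₂; _×_; _,_; proj₁; proj₂)
open import Data.Product.Properties using (≡-dec)
open import Data.Product.Relation.Binary.Lex.NonStrict using (×-decTotalOrder)
open import Data.Product.Relation.Binary.Pointwise.NonDependent using (≡×≡⇒≡)
open import Data.List using (List; []; _∷_; length; map; filter; deduplicate; cartesianProduct; upTo)
open import Data.List.Properties using (length-map; length-++; length-upTo; map-cong; map-∘; map-cong-local; map-id)
open import Data.List.Relation.Unary.All as All using (All; []; _∷_)
open import Data.List.Relation.Unary.All.Properties using (map⁺)
open import Data.List.Relation.Unary.AllPairs using (AllPairs; []; _∷_)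
open import Data.List.Relation.Unary.Any using (here; there)
open import Data.List.Relation.Unary.Unique.Propositional using (Unique)
import Data.List.Relation.Unary.Unique.Propositional.Properties as Unique
open import Data.List.Relation.Unary.Unique.DecPropositional.Properties (≡-dec _≟_ _≟_) using (deduplicate-!)
open import Data.List.Membership.Propositional using (_∈_)
open import Data.List.Membership.Propositional.Properties using (∈-map⁻; ∈-filter⁻; ∈-deduplicate⁻; ∈-cartesianProduct⁺; ∈-upTo⁺)
open import Data.List.Relation.Binary.Permutation.Propositional using (↭-sym; ↭⇒↭ₛ)
open import Data.List.Relation.Binary.Permutation.Propositional.Properties using (∈-resp-↭; ↭-length)
import Data.List.Relation.Binary.Permutation.Setoid.Properties as Permutationₛ
open import Data.List.Relation.Unary.Sorted.TotalOrder.Properties using (Sorted⇒AllPairs)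
open import Algebra.Properties.CommutativeSemigroup +-commutativeSemigroup using (interchange)
import Relation.Binary.Construct.Flip.Ord as Flip
open import Relation.Binary.Bundles using (DecTotalOrder)
open import Relation.Binary.Definitions using (DecidableEquality)
open import Relation.Nullary using (¬_; yes; no; contradiction)
open import Relation.Nullary.Decidable using (dec-true)
open import Relation.Unary using (Pred; Decidable)
open import Relation.Unary.Properties using (∁?)
open import Relation.Binary.PropositionalEquality
open import Level using (0ℓ)

open Fibonacci
open FibonacciLattice using (double; fibonacciBox)

bracket : ∀ W → 2 ≤ W → ∃ λ w → fib (3 + double w) ≤ W × W < fib (5 + double w)
bracket (suc (suc zero))    _ = 0 , ≤-refl , s≤s (s≤s (s≤s z≤n))
bracket (suc zero) (s≤s ())
bracket (suc (suc (suc W))) _ with bracket (suc (suc W)) (s≤s (s≤s z≤n))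
... | w , lo , hi with suc (suc (suc W)) <? fib (5 + double w)
...   | yes hi′ = w , m≤n⇒m≤1+n lo , hi′
...   | no  ¬hi′ = suc w , ≮⇒≥ ¬hi′ , ≤-<-trans hi (fib-<-2 (4 + double w))

-- If W , H ≤ f(k) and W H > 9 f(k), then k = 2w + u + 2 with f(2w+3) ≤ W and
-- f(u+2) ≤ H: take the bracket of W; a too small H would give W H ≤ f(2w+5) f(u+2) ≤ 9 f(k).
splitIndex : ∀ k W H → W ≤ fib k → H ≤ fib k → 9 * fib k < W * H →
  ∃₂ λ w u → k ≡ 2 + double w + u × fib (3 + double w) ≤ W × fib (2 + u) ≤ H
splitIndex k W H W≤ H≤ big with 2 ≤? W
... | no W<2 = contradiction big (≤⇒≯ (begin
  W * H    ≤⟨ *-monoˡ-≤ H (≤-pred (≰⇒> W<2)) ⟩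
  1 * H    ≡⟨ *-identityˡ H ⟩
  H        ≤⟨ H≤ ⟩
  fib k    ≤⟨ m≤m+n (fib k) _ ⟩
  9 * fib k ∎))
  where open ≤-Reasoning
... | yes W≥2 with bracket W W≥2
...   | w , lo , hi with 2 + double w ≤? k
...     | no k<2+e = contradiction (≤-trans lo W≤) (<⇒≱ (≤-<-trans (fib-mono (≤-pred (≰⇒> k<2+e))) (fib-<-2 (double w))))
...     | yes 2+e≤k with fib (2 + (k ∸ (2 + double w))) ≤? H
...       | yes H≥ = w , k ∸ (2 + double w) , sym (m+[n∸m]≡n 2+e≤k) , lo , H≥
...       | no  H< = contradiction big (≤⇒≯ (begin
  W * H                         ≤⟨ *-mono-≤ (<⇒≤ hi) (<⇒≤ (≰⇒> H<)) ⟩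
  fib (5 + e) * fib (2 + u)     ≡⟨ *-comm (fib (5 + e)) (fib (2 + u)) ⟩
  fib (2 + u) * fib (5 + e)     ≤⟨ m≤n+m _ (fib (1 + u) * fib (4 + e)) ⟩
  fib (1 + u) * fib (4 + e) + fib (2 + u) * fib (5 + e) ≡⟨ fib-add (3 + e) (1 + u) ⟨
  fib (5 + (e + suc u))         ≡⟨ cong (λ i → fib (5 + i)) (+-suc e u) ⟩
  fib (6 + (e + u))             ≤⟨ fib-6≤9 (e + u) ⟩
  9 * fib (2 + e + u)           ≡⟨ cong (λ i → 9 * fib i) (m+[n∸m]≡n 2+e≤k) ⟩
  9 * fib k                     ∎))
  where
  open ≤-Reasoning
  e u : ℕ
  e = double w
  u = k ∸ (2 + e)

HitsBox-mono : ∀ {k X W W′ Y H H′} → W ≤ W′ → H ≤ H′ → HitsBox k X W Y H → HitsBox k X W′ Y H′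
HitsBox-mono W≤ H≤ (j , X≤j , j< , Y≤ , <YH) =
  j , X≤j , <-≤-trans j< (+-monoʳ-≤ _ W≤) , Y≤ , <-≤-trans <YH (+-monoʳ-≤ _ H≤)

fibonacciLatticeHitsBox : ∀ k X W Y H → W ≤ fib k → Y + H ≤ fib k → 9 * fib k < W * H → HitsBox k X W Y H
fibonacciLatticeHitsBox k X W Y H W≤ YH≤ big
  with splitIndex k W H W≤ (≤-trans (m≤n+m H Y) YH≤) big
... | w , u , refl , fW≤W , fH≤H =
  HitsBox-mono {2 + double w + u} fW≤W fH≤H (fibonacciBox w u X Y (≤-trans (+-monoʳ-≤ Y fH≤H) YH≤))

nextMultiple : ∀ a σ .{{_ : NonZero σ}} → a < σ * suc (a / σ) × σ * suc (a / σ) ≤ a + σ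
nextMultiple a σ = above , below
  where
  open ≤-Reasoning
  unfold : σ * suc (a / σ) ≡ a / σ * σ + σ
  unfold = trans (*-suc σ (a / σ)) (trans (+-comm σ (σ * (a / σ))) (cong (_+ σ) (*-comm σ (a / σ))))
  above : a < σ * suc (a / σ)
  above = begin-strict
    a                      ≡⟨ m≡m%n+[m/n]*n a σ ⟩
    a % σ + a / σ * σ      <⟨ +-monoˡ-< (a / σ * σ) (m%n<n a σ) ⟩
    σ + a / σ * σ          ≡⟨ trans (+-comm σ _) (sym unfold) ⟩
    σ * suc (a / σ)        ∎
  below : σ * suc (a / σ) ≤ a + σ
  below = begin
    σ * suc (a / σ)        ≡⟨ unfold ⟩
    a / σ * σ + σ          ≤⟨ +-monoˡ-≤ σ (m/n*n≤m a σ) ⟩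
    a + σ                  ∎

divℕ≡/ : ∀ x d .{{_ : NonZero d}} → divℕ x d ≡ x / d
divℕ≡/ x (suc d) = refl

≤-floor : ∀ a x d .{{_ : NonZero d}} → a * d ≤ x → a ≤ x / d
≤-floor a x d h = ≤-trans (≤-reflexive (sym (m*n/n≡m a d))) (/-monoˡ-≤ d h)

-- A coordinate z < n is scaled to z ℓ and cut into cells of
-- size g (cell index ⌊z ℓ / g⌋); the lattice points have scaled coordinates σ t with
-- t < m, where n ℓ = σ m and σ ≤ g (lattice spacing at most the cell size).
module Axis (ℓ g σ n m : ℕ) .{{_ : NonZero g}} .{{_ : NonZero σ}} .{{_ : NonZero ℓ}}
            (σ≤g : σ ≤ g) (scale : n * ℓ ≡ σ * m) where

  cell : ℕ → ℕ
  cell z = (z * ℓ) / g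

  -- For z in a cell c ≥ 4 there is a run [X , X+W) of lattice indices with σ W > 3 g,
  -- all of whose coordinates lie at or below z, and such that every coordinate at or
  -- above σ X lies in a cell ≥ c − 4: take the multiples of σ in [(c−4) g , c g].
  window : ∀ z → z < n → 4 ≤ cell z → ∃₂ λ X W →
    X + W ≤ m × 3 * g < σ * W ×
    (∀ t → t < X + W → σ * t ≤ z * ℓ) ×
    (∀ t z′ → X ≤ t → σ * t ≤ z′ * ℓ → cell z ≤ cell z′ + 4)
  window z z<n c≥4 = X , W , X+W≤m , proj₁ (nextMultiple (3 * g) σ) , below-z , above-X
    where
    open ≤-Reasoning
    c lo X W : ℕ
    c = cell z
    lo = (c ∸ 4) * g
    X = suc (lo / σ)
    W = suc (3 * g / σ)
    cg≤zℓ : c * g ≤ z * ℓ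
    cg≤zℓ = m/n*n≤m (z * ℓ) g
    span : σ * (X + W) ≤ c * g + σ
    span = begin
      σ * (X + W)                   ≡⟨ *-distribˡ-+ σ X W ⟩
      σ * X + σ * W                 ≤⟨ +-mono-≤ (proj₂ (nextMultiple lo σ)) (proj₂ (nextMultiple (3 * g) σ)) ⟩
      (lo + σ) + (3 * g + σ)        ≤⟨ +-monoʳ-≤ (lo + σ) (+-monoʳ-≤ (3 * g) σ≤g) ⟩
      (lo + σ) + (3 * g + g)        ≡⟨ regroup (c ∸ 4) σ g ⟩
      ((c ∸ 4) + 4) * g + σ         ≡⟨ cong (λ d → d * g + σ) (m∸n+n≡m c≥4) ⟩
      c * g + σ                     ∎
      where
      regroup : ∀ a σ g → (a * g + σ) + (3 * g + g) ≡ (a + 4) * g + σ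
      regroup = ℕ-Ring.solve-∀
    X+W≤m : X + W ≤ m
    X+W≤m = ≤-pred (*-cancelˡ-< σ (X + W) (suc m) (begin-strict
      σ * (X + W)      ≤⟨ span ⟩
      c * g + σ        ≤⟨ +-monoˡ-≤ σ cg≤zℓ ⟩
      z * ℓ + σ        <⟨ +-monoˡ-< σ (*-monoˡ-< ℓ z<n) ⟩
      n * ℓ + σ        ≡⟨ cong (_+ σ) scale ⟩
      σ * m + σ        ≡⟨ trans (+-comm (σ * m) σ) (sym (*-suc σ m)) ⟩
      σ * suc m        ∎))
    below-z : ∀ t → t < X + W → σ * t ≤ z * ℓ
    below-z t t<X+W = ≤-trans (+-cancelʳ-≤ σ (σ * t) (c * g) (begin
      σ * t + σ        ≡⟨ trans (+-comm (σ * t) σ) (sym (*-suc σ t)) ⟩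
      σ * suc t        ≤⟨ *-monoʳ-≤ σ t<X+W ⟩
      σ * (X + W)      ≤⟨ span ⟩
      c * g + σ        ∎)) cg≤zℓ
    above-X : ∀ t z′ → X ≤ t → σ * t ≤ z′ * ℓ → cell z ≤ cell z′ + 4
    above-X t z′ X≤t σt≤z′ℓ = begin
      c                ≡⟨ m∸n+n≡m c≥4 ⟨
      (c ∸ 4) + 4      ≤⟨ +-monoˡ-≤ 4 (≤-floor (c ∸ 4) (z′ * ℓ) g (begin
        lo             ≤⟨ <⇒≤ (proj₁ (nextMultiple lo σ)) ⟩
        σ * X          ≤⟨ *-monoʳ-≤ σ X≤t ⟩
        σ * t          ≤⟨ σt≤z′ℓ ⟩
        z′ * ℓ         ∎)) ⟩
      cell z′ + 4      ∎

_≼_ : Point → Point → Set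
(a , b) ≼ (x , y) = a ≤ x × b ≤ y

domInd-≼ : ∀ P q → P ≼ q → domInd P q ≡ 1
domInd-≼ (a , b) (x , y) (a≤x , b≤y) =
  cong₂ (λ u v → if u ∧ v then 1 else 0) (dec-true (a ≤? x) a≤x) (dec-true (b ≤? y) b≤y)

domInd-⋠ : ∀ P q → ¬ (P ≼ q) → domInd P q ≡ 0
domInd-⋠ (a , b) (x , y) P⋠q with a ≤ᵇ x in a≤ᵇx | b ≤ᵇ y in b≤ᵇy
... | true  | true  = contradiction (≤ᵇ⇒≤ a x (subst T (sym a≤ᵇx) tt) , ≤ᵇ⇒≤ b y (subst T (sym b≤ᵇy) tt)) P⋠q
... | true  | false = refl
... | false | _     = refl

largeBox : ∀ n m s μ → n ≡ s * m → ∀ {W H} → 3 * μ < s * W → 3 * (n * n) < n * μ * H → 9 * m < W * H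
largeBox n m s μ n≡sm {W} {H} wideX wideY = *-cancelʳ-< (s * μ * n) (9 * m) (W * H) (begin-strict
    9 * m * (s * μ * n)        ≡⟨ regroup₁ m s μ n ⟩
    9 * μ * n * (s * m)        ≡⟨ cong (9 * μ * n *_) n≡sm ⟨
    9 * μ * n * n              ≡⟨ regroup₂ μ n ⟩
    3 * μ * (3 * (n * n))      <⟨ *-mono-< wideX wideY ⟩
    s * W * (n * μ * H)        ≡⟨ regroup₃ s W n μ H ⟩
    W * H * (s * μ * n)        ∎)
    where
    open ≤-Reasoning
    regroup₁ : ∀ m s μ n → 9 * m * (s * μ * n) ≡ 9 * μ * n * (s * m)
    regroup₁ = ℕ-Ring.solve-∀
    regroup₂ : ∀ μ n → 9 * μ * n * n ≡ 3 * μ * (3 * (n * n))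
    regroup₂ = ℕ-Ring.solve-∀
    regroup₃ : ∀ s W n μ H → s * W * (n * μ * H) ≡ W * H * (s * μ * n)
    regroup₃ = ℕ-Ring.solve-∀

module Grid (n m k μ s : ℕ) (fk : fib k ≡ m) (n≡sm : n ≡ s * m) (s≥1 : 1 ≤ s) (m≥1 : 1 ≤ m)
            (s≤μ : s ≤ μ) (μ≤n : μ ≤ n) where

  private
    μ≥1 : 1 ≤ μ
    μ≥1 = ≤-trans s≥1 s≤μ
    n≥1 : 1 ≤ n
    n≥1 = ≤-trans μ≥1 μ≤n
    instance
      s≢0 : NonZero s
      s≢0 = >-nonZero s≥1
      m≢0 : NonZero m
      m≢0 = >-nonZero m≥1
      μ≢0 : NonZero μ
      μ≢0 = >-nonZero μ≥1
      mμ≢0 : NonZero (m * μ)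
      mμ≢0 = >-nonZero (*-mono-≤ m≥1 μ≥1)
      nn≢0 : NonZero (n * n)
      nn≢0 = >-nonZero (*-mono-≤ n≥1 n≥1)
      nμ≢0 : NonZero (n * μ)
      nμ≢0 = >-nonZero (*-mono-≤ n≥1 μ≥1)

  col : ℕ → ℕ
  col x = divℕ x μ

  row : ℕ → ℕ
  row y = divℕ (y * (m * μ)) (n * n)

  latticePt≡ : ∀ j → latticePt n m k j ≡ (s * j , s * fibY k j)
  latticePt≡ j = cong₂ (λ d π → (d * j , d * π)) spacing (cong (modℕ (j * fib (k ∸ 1))) (sym fk))
    where
    spacing : divℕ n m ≡ s
    spacing = trans (divℕ≡/ n m) (trans (cong (_/ m) n≡sm) (m*n/n≡m s m))

  -- Columns: coordinate x, cells of size μ, lattice spacing s.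
  -- Rows: coordinate y scaled by m μ, cells of size n², lattice spacing n μ.
  private
    module Columns = Axis 1 μ s n m s≤μ (trans (*-identityʳ n) n≡sm)
    rotate : ∀ n m μ → n * (m * μ) ≡ n * μ * m
    rotate = ℕ-Ring.solve-∀
    module Rows = Axis (m * μ) (n * n) (n * μ) n m (*-monoʳ-≤ n μ≤n) (rotate n m μ)

  col≡cell : ∀ x → col x ≡ Columns.cell x
  col≡cell x = trans (divℕ≡/ x μ) (cong (_/ μ) (sym (*-identityʳ x)))

  row≡cell : ∀ y → row y ≡ Rows.cell y
  row≡cell y = divℕ≡/ (y * (m * μ)) (n * n)

  col-bound : ∀ {x} → x < n → col x * μ < n
  col-bound {x} x<n = ≤-<-trans (subst (λ c → c * μ ≤ x) (sym (divℕ≡/ x μ)) (m/n*n≤m x μ)) x<n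

  row-bound : ∀ {y} → y < n → row y * n < m * μ
  row-bound {y} y<n = *-cancelʳ-< n (row y * n) (m * μ) (begin-strict
    row y * n * n        ≡⟨ *-assoc (row y) n n ⟩
    row y * (n * n)      ≤⟨ subst (λ r → r * (n * n) ≤ y * (m * μ)) (sym (divℕ≡/ _ (n * n))) (m/n*n≤m (y * (m * μ)) (n * n)) ⟩
    y * (m * μ)          <⟨ *-monoˡ-< (m * μ) y<n ⟩
    n * (m * μ)          ≡⟨ *-comm n (m * μ) ⟩
    m * μ * n            ∎)
    where open ≤-Reasoning

  rowScale : ∀ t → n * μ * t ≡ s * t * (m * μ)
  rowScale t = trans (cong (λ z → z * μ * t) n≡sm) (regroup s m μ t)
    where
    regroup : ∀ s m μ t → s * m * μ * t ≡ s * t * (m * μ)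
    regroup = ℕ-Ring.solve-∀

  ≼-from-axes : ∀ j x y → s * j ≤ x * 1 → n * μ * fibY k j ≤ y * (m * μ) → latticePt n m k j ≼ (x , y)
  ≼-from-axes j x y sj≤x sπ≤y = subst (_≼ (x , y)) (sym (latticePt≡ j))
    ( subst (s * j ≤_) (*-identityʳ x) sj≤x
    , *-cancelʳ-≤ (s * fibY k j) y (m * μ) (subst (_≤ y * (m * μ)) (rowScale (fibY k j)) sπ≤y))

  ≼-to-axes : ∀ j x y → latticePt n m k j ≼ (x , y) → s * j ≤ x * 1 × n * μ * fibY k j ≤ y * (m * μ)
  ≼-to-axes j x y Pj≼q with subst (_≼ (x , y)) (latticePt≡ j) Pj≼q
  ... | sj≤x , sπ≤y = subst (s * j ≤_) (sym (*-identityʳ x)) sj≤x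
                    , subst (_≤ y * (m * μ)) (sym (rowScale (fibY k j))) (*-monoˡ-≤ (m * μ) sπ≤y)

  -- A query q = (x , y) whose cell has column ≥ 4 and row ≥ 4 dominates a lattice
  -- point P_j all of whose dominators lie in cells at most four columns to the left
  -- and four rows below the cell of q: the column and row windows below q span a box
  -- of area > 9 m in lattice units, which the Fibonacci lattice hits.
  anchor : ∀ x y → x < n → y < n → 4 ≤ col x → 4 ≤ row y →
    ∃ λ j → j < m × latticePt n m k j ≼ (x , y) ×
      (∀ x′ y′ → latticePt n m k j ≼ (x′ , y′) → col x ≤ col x′ + 4 × row y ≤ row y′ + 4)
  anchor x y x<n y<n c≥4 r≥4 =
    let X , W , X+W≤m , wideX , belowX , aboveX = Columns.window x x<n (subst (4 ≤_) (col≡cell x) c≥4)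
        Y , H , Y+H≤m , wideY , belowY , aboveY = Rows.window y y<n (subst (4 ≤_) (row≡cell y) r≥4)
        j , X≤j , j<X+W , Y≤π , π<Y+H = fibonacciLatticeHitsBox k X W Y H
          (subst (W ≤_) (sym fk) (≤-trans (m≤n+m W X) X+W≤m)) (subst (Y + H ≤_) (sym fk) Y+H≤m)
          (subst (λ f → 9 * f < W * H) (sym fk) (largeBox n m s μ n≡sm wideX wideY))
        near : ∀ x′ y′ → latticePt n m k j ≼ (x′ , y′) → col x ≤ col x′ + 4 × row y ≤ row y′ + 4
        near x′ y′ Pj≼q′ =
          let sj≤x′ , sπ≤y′ = ≼-to-axes j x′ y′ Pj≼q′
          in subst₂ (λ a b → a ≤ b + 4) (sym (col≡cell x)) (sym (col≡cell x′)) (aboveX j x′ X≤j sj≤x′)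
           , subst₂ (λ a b → a ≤ b + 4) (sym (row≡cell y)) (sym (row≡cell y′)) (aboveY (fibY k j) y′ Y≤π sπ≤y′)
    in j , <-≤-trans j<X+W X+W≤m , ≼-from-axes j x y (belowX j j<X+W) (belowY (fibY k j) π<Y+H) , near

data Triangular (d : ℕ) : List (ℕ → ℕ) → Set where
  []   : Triangular d []
  _∷_ : ∀ {v vs} → (∃ λ j → j < d × v j ≡ 1 × All (λ w → w j ≡ 0) vs) → Triangular d vs → Triangular d (v ∷ vs)

linComb-zero : ∀ {j} vs → All (λ w → w j ≡ 0) vs → ∀ cs → linComb cs vs j ≡ 0
linComb-zero []       []       []       = refl
linComb-zero []       []       (_ ∷ _)  = refl
linComb-zero (v ∷ vs) (_ ∷ _)  []       = refl
linComb-zero (v ∷ vs) (vj≡0 ∷ ps) (c ∷ cs) =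
  cong₂ _+_ (trans (cong (c *_) vj≡0) (*-zeroʳ c)) (linComb-zero vs ps cs)

-- Triangular families are linearly independent modulo every Δ: at the pivot of the
-- first vector only its own coefficient contributes, so Δ divides it; peel it off.
triangular⇒independent : ∀ {Δ d vs} → Triangular d vs → LinIndep Δ d vs
triangular⇒independent []                                  []       _   _ = []
triangular⇒independent {Δ} {d} ((j , j<d , vj≡1 , later) ∷ tri) (c ∷ cs) len Δ∣comb =
  Δ∣c ∷ triangular⇒independent tri cs (suc-injective len) Δ∣rest
  where
  Δ∣c : Δ ∣ c
  Δ∣c = subst (Δ ∣_) (trans (cong₂ _+_ (trans (cong (c *_) vj≡1) (*-identityʳ c)) (linComb-zero _ later cs)) (+-identityʳ c))
          (Δ∣comb j j<d)
  Δ∣rest : ∀ j′ → j′ < d → Δ ∣ linComb cs _ j′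
  Δ∣rest j′ j′<d = ∣m+n∣m⇒∣n (Δ∣comb j′ j′<d) (∣m⇒∣m*n _ Δ∣c)

module _ {A : Set} where

  length-split : ∀ {P : Pred A 0ℓ} (P? : Decidable P) xs →
    length xs ≡ length (filter P? xs) + length (filter (∁? P?) xs)
  length-split P? []       = refl
  length-split P? (x ∷ xs) with P? x
  ... | yes _ = cong suc (length-split P? xs)
  ... | no  _ = trans (cong suc (length-split P? xs)) (sym (+-suc _ _))

  remove : ∀ {x : A} {ys} → x ∈ ys → List A
  remove {ys = _ ∷ ys} (here _)  = ys
  remove {ys = y ∷ _}  (there p) = y ∷ remove p

  length-remove : ∀ {x : A} {ys} (p : x ∈ ys) → length ys ≡ suc (length (remove p))
  length-remove (here _)  = refl
  length-remove (there p) = cong suc (length-remove p)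

  ∈-remove : ∀ {x z : A} {ys} (p : x ∈ ys) → z ∈ ys → z ≢ x → z ∈ remove p
  ∈-remove (here refl) (here refl) z≢x = contradiction refl z≢x
  ∈-remove (here refl) (there q)   _   = q
  ∈-remove (there p)   (here refl) _   = here refl
  ∈-remove (there p)   (there q)   z≢x = there (∈-remove p q z≢x)

  unique-⊆-length : ∀ {xs ys : List A} → Unique xs → (∀ {z} → z ∈ xs → z ∈ ys) → length xs ≤ length ys
  unique-⊆-length {[]}     _          _   = z≤n
  unique-⊆-length {x ∷ xs} (x∉xs ∷ u) xs⊆ys = ≤-trans (s≤s (unique-⊆-length u xs⊆rest))
                                                 (≤-reflexive (sym (length-remove (xs⊆ys (here refl)))))
    where
    xs⊆rest : ∀ {z} → z ∈ xs → z ∈ remove (xs⊆ys (here refl))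
    xs⊆rest z∈xs = ∈-remove (xs⊆ys (here refl)) (xs⊆ys (there z∈xs)) (λ z≡x → All.lookup x∉xs z∈xs (sym z≡x))

length-cartesianProduct : ∀ {A B : Set} (xs : List A) (ys : List B) →
  length (cartesianProduct xs ys) ≡ length xs * length ys
length-cartesianProduct []       ys = refl
length-cartesianProduct (x ∷ xs) ys =
  trans (length-++ (map (x ,_) ys)) (cong₂ _+_ (length-map (x ,_) ys) (length-cartesianProduct xs ys))

boxCount : ∀ (L : List (ℕ × ℕ)) A B → Unique L → All (λ κ → proj₁ κ < A × proj₂ κ < B) L → length L ≤ A * B
boxCount L A B u inBox = ≤-trans (unique-⊆-length u L⊆box)
  (≤-reflexive (trans (length-cartesianProduct (upTo A) (upTo B)) (cong₂ _*_ (length-upTo A) (length-upTo B))))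
  where
  L⊆box : ∀ {κ} → κ ∈ L → κ ∈ cartesianProduct (upTo A) (upTo B)
  L⊆box κ∈L = let a<A , b<B = All.lookup inBox κ∈L in ∈-cartesianProduct⁺ (∈-upTo⁺ a<A) (∈-upTo⁺ b<B)

module Classes {A C : Set} (f : A → C) (_≟_ : DecidableEquality C) where

  count : C → List A → ℕ
  count t L = length (filter (λ a → f a ≟ t) L)

  private
    sum-map-+ : ∀ (g h : C → ℕ) T → sum (map (λ t → g t + h t) T) ≡ sum (map g T) + sum (map h T)
    sum-map-+ g h []      = refl
    sum-map-+ g h (t ∷ T) = trans (cong (g t + h t +_) (sum-map-+ g h T)) (interchange (g t) (h t) _ _)

    count-∷ : ∀ a L t → count t (a ∷ L) ≡ count t (a ∷ []) + count t L
    count-∷ a L t with f a ≟ t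
    ... | yes _ = refl
    ... | no  _ = refl

    counted : ∀ a T → f a ∈ T → 1 ≤ sum (map (λ t → count t (a ∷ [])) T)
    counted a (t ∷ T) (here fa≡t) with f a ≟ t
    ... | yes _    = s≤s z≤n
    ... | no fa≢t  = contradiction fa≡t fa≢t
    counted a (t ∷ T) (there fa∈T) = ≤-trans (counted a T fa∈T) (m≤n+m _ _)

  length≤Σcount : ∀ T L → All (λ a → f a ∈ T) L → length L ≤ sum (map (λ t → count t L) T)
  length≤Σcount T []      []            = z≤n
  length≤Σcount T (a ∷ L) (fa∈T ∷ L⊆T) = begin
    1 + length L
      ≤⟨ +-mono-≤ (counted a T fa∈T) (length≤Σcount T L L⊆T) ⟩
    sum (map (λ t → count t (a ∷ [])) T) + sum (map (λ t → count t L) T)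
      ≡⟨ sum-map-+ (λ t → count t (a ∷ [])) (λ t → count t L) T ⟨
    sum (map (λ t → count t (a ∷ []) + count t L) T)
      ≡⟨ cong sum (map-cong (λ t → sym (count-∷ a L t)) T) ⟩
    sum (map (λ t → count t (a ∷ L)) T) ∎
    where open ≤-Reasoning

  sum≤length*max : ∀ (g : C → ℕ) t₀ T → ∃ λ t → sum (map g (t₀ ∷ T)) ≤ length (t₀ ∷ T) * g t
  sum≤length*max g t₀ []        = t₀ , ≤-refl
  sum≤length*max g t₀ (t₁ ∷ T) with sum≤length*max g t₁ T
  ... | t , bound with g t₀ ≤? g t
  ...   | yes g₀≤ = t , +-mono-≤ g₀≤ bound
  ...   | no  g₀≰ = t₀ , +-monoʳ-≤ (g t₀) (≤-trans bound (*-monoʳ-≤ (length (t₁ ∷ T)) (<⇒≤ (≰⇒> g₀≰))))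

  pigeonhole : ∀ t₀ T L → All (λ a → f a ∈ t₀ ∷ T) L → ∃ λ t → length L ≤ length (t₀ ∷ T) * count t L
  pigeonhole t₀ T L L⊆T =
    let t , average = sum≤length*max (λ t → count t L) t₀ T
    in t , ≤-trans (length≤Σcount (t₀ ∷ T) L L⊆T) average

congruent-≤ : ∀ d .{{_ : NonZero d}} a b → a < b + d → a % d ≡ b % d → a ≤ b
congruent-≤ d a b a<b+d a≡b with a / d ≤? b / d
... | yes qa≤qb = begin
  a                  ≡⟨ m≡m%n+[m/n]*n a d ⟩
  a % d + a / d * d  ≤⟨ +-mono-≤ (≤-reflexive a≡b) (*-monoˡ-≤ d qa≤qb) ⟩
  b % d + b / d * d  ≡⟨ m≡m%n+[m/n]*n b d ⟨
  b                  ∎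
  where open ≤-Reasoning
... | no  qa≰qb = contradiction a<b+d (≤⇒≯ (begin
  b + d                    ≡⟨ cong (_+ d) (m≡m%n+[m/n]*n b d) ⟩
  b % d + b / d * d + d    ≡⟨ +-assoc (b % d) _ d ⟩
  b % d + (b / d * d + d)  ≡⟨ cong (b % d +_) (+-comm (b / d * d) d) ⟩
  b % d + suc (b / d) * d  ≤⟨ +-mono-≤ (≤-reflexive (sym a≡b)) (*-monoˡ-≤ d (≰⇒> qa≰qb)) ⟩
  a % d + a / d * d        ≡⟨ m≡m%n+[m/n]*n a d ⟨
  a                        ∎))
  where open ≤-Reasoning

ceiling : ∀ a d .{{_ : NonZero d}} → 1 ≤ a → ∃ λ R → (∀ r → r * d < a → r < R) × R * d < a + d
ceiling (suc a) d _ = R , below , overshoot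
  where
  open ≤-Reasoning
  R : ℕ
  R = suc (a / d)
  overshoot : R * d < suc a + d
  overshoot = begin-strict
    R * d     ≡⟨ *-comm R d ⟩
    d * R     ≤⟨ proj₂ (nextMultiple a d) ⟩
    a + d     <⟨ n<1+n (a + d) ⟩
    suc a + d ∎
  below : ∀ r → r * d < suc a → r < R
  below r rd<1+a = *-cancelʳ-< d r R (begin-strict
    r * d     ≤⟨ s≤s⁻¹ rd<1+a ⟩
    a         <⟨ proj₁ (nextMultiple a d) ⟩
    d * R     ≡⟨ *-comm d R ⟩
    R * d     ∎)

private
  -- 4 x + 4 y ≤ 5 y + 5 x, to bring the three cases of `boundaryArea` to one form
  slack : ∀ x y → 4 * x + 4 * y ≤ 5 * y + 5 * x
  slack x y = ≤-trans (+-mono-≤ (*-monoˡ-≤ x (n≤1+n 4)) (*-monoˡ-≤ y (n≤1+n 4))) (≤-reflexive (+-comm (5 * x) (5 * y)))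

-- The three cases C ≤ 4,
-- R ≤ 4 and C , R ≥ 5 are needed because only in the last one 4μ < n and 4n < m μ.
boundaryArea : ∀ n μ m C R b → b ≤ C * R → b ≤ 4 * R + 4 * C → C * μ < n + μ → R * n < m * μ + n →
  μ ≤ n → n ≤ μ * m → b * μ * n ≤ 5 * (n * n) + 5 * (μ * μ * m)
boundaryArea n μ m C R b b≤CR b≤4R+4C Cμ< Rn< μ≤n n≤μm with C ≤? 4 | R ≤? 4
... | yes C≤4 | _ = begin
  b * μ * n                       ≤⟨ *-monoˡ-≤ n (*-monoˡ-≤ μ (≤-trans b≤CR (*-monoˡ-≤ R C≤4))) ⟩
  4 * R * μ * n                   ≡⟨ e₁ R μ n ⟩
  4 * μ * (R * n)                 ≤⟨ *-monoʳ-≤ (4 * μ) (<⇒≤ Rn<) ⟩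
  4 * μ * (m * μ + n)             ≡⟨ e₂ μ m n ⟩
  4 * (μ * μ * m) + 4 * (μ * n)   ≤⟨ +-monoʳ-≤ (4 * (μ * μ * m)) (*-monoʳ-≤ 4 (*-monoˡ-≤ n μ≤n)) ⟩
  4 * (μ * μ * m) + 4 * (n * n)   ≤⟨ slack (μ * μ * m) (n * n) ⟩
  5 * (n * n) + 5 * (μ * μ * m)   ∎
  where
  open ≤-Reasoning
  e₁ : ∀ R μ n → 4 * R * μ * n ≡ 4 * μ * (R * n)
  e₁ = ℕ-Ring.solve-∀
  e₂ : ∀ μ m n → 4 * μ * (m * μ + n) ≡ 4 * (μ * μ * m) + 4 * (μ * n)
  e₂ = ℕ-Ring.solve-∀
... | no _ | yes R≤4 = begin
  b * μ * n                       ≤⟨ *-monoˡ-≤ n (*-monoˡ-≤ μ (≤-trans b≤CR (*-monoʳ-≤ C R≤4))) ⟩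
  C * 4 * μ * n                   ≡⟨ e₁ C μ n ⟩
  4 * n * (C * μ)                 ≤⟨ *-monoʳ-≤ (4 * n) (<⇒≤ Cμ<) ⟩
  4 * n * (n + μ)                 ≡⟨ e₂ μ n ⟩
  4 * (n * n) + 4 * (μ * n)       ≤⟨ +-monoʳ-≤ (4 * (n * n)) (*-monoʳ-≤ 4 (≤-trans (*-monoʳ-≤ μ n≤μm) (≤-reflexive (sym (*-assoc μ μ m))))) ⟩
  4 * (n * n) + 4 * (μ * μ * m)   ≤⟨ slack (n * n) (μ * μ * m) ⟩
  5 * (μ * μ * m) + 5 * (n * n)   ≡⟨ +-comm (5 * (μ * μ * m)) (5 * (n * n)) ⟩
  5 * (n * n) + 5 * (μ * μ * m)   ∎
  where
  open ≤-Reasoning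
  e₁ : ∀ C μ n → C * 4 * μ * n ≡ 4 * n * (C * μ)
  e₁ = ℕ-Ring.solve-∀
  e₂ : ∀ μ n → 4 * n * (n + μ) ≡ 4 * (n * n) + 4 * (μ * n)
  e₂ = ℕ-Ring.solve-∀
... | no C≰4 | no R≰4 = begin
  b * μ * n                                         ≤⟨ *-monoˡ-≤ n (*-monoˡ-≤ μ b≤4R+4C) ⟩
  (4 * R + 4 * C) * μ * n                           ≡⟨ e₁ R C μ n ⟩
  4 * μ * (R * n) + 4 * n * (C * μ)                 ≤⟨ +-mono-≤ (*-monoʳ-≤ (4 * μ) (<⇒≤ Rn<)) (*-monoʳ-≤ (4 * n) (<⇒≤ Cμ<)) ⟩
  4 * μ * (m * μ + n) + 4 * n * (n + μ)             ≡⟨ e₂ μ m n ⟩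
  4 * (μ * μ * m) + 4 * (n * n) + (μ * (4 * n) + n * (4 * μ))
    ≤⟨ +-monoʳ-≤ (4 * (μ * μ * m) + 4 * (n * n)) (+-mono-≤ (*-monoʳ-≤ μ (<⇒≤ 4n<mμ)) (*-monoʳ-≤ n (<⇒≤ 4μ<n))) ⟩
  4 * (μ * μ * m) + 4 * (n * n) + (μ * (m * μ) + n * n) ≡⟨ e₃ μ m n ⟩
  5 * (n * n) + 5 * (μ * μ * m)                     ∎
  where
  open ≤-Reasoning
  -- five columns (rows) fit strictly inside n + μ (m μ + n)
  4μ<n : 4 * μ < n
  4μ<n = +-cancelʳ-< μ (4 * μ) n (≤-<-trans (≤-reflexive (+-comm (4 * μ) μ)) (≤-<-trans (*-monoˡ-≤ μ (≰⇒> C≰4)) Cμ<))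
  4n<mμ : 4 * n < m * μ
  4n<mμ = +-cancelʳ-< n (4 * n) (m * μ) (≤-<-trans (≤-reflexive (+-comm (4 * n) n)) (≤-<-trans (*-monoˡ-≤ n (≰⇒> R≰4)) Rn<))
  e₁ : ∀ R C μ n → (4 * R + 4 * C) * μ * n ≡ 4 * μ * (R * n) + 4 * n * (C * μ)
  e₁ = ℕ-Ring.solve-∀
  e₂ : ∀ μ m n → 4 * μ * (m * μ + n) + 4 * n * (n + μ) ≡ 4 * (μ * μ * m) + 4 * (n * n) + (μ * (4 * n) + n * (4 * μ))
  e₂ = ℕ-Ring.solve-∀
  e₃ : ∀ μ m n → 4 * (μ * μ * m) + 4 * (n * n) + (μ * (m * μ) + n * n) ≡ 5 * (n * n) + 5 * (μ * μ * m)
  e₃ = ℕ-Ring.solve-∀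

∸∸-≤ : ∀ x y a b → x ≤ y + a + b → x ∸ a ∸ b ≤ y
∸∸-≤ x y a b x≤ = begin
  x ∸ a ∸ b            ≡⟨ ∸-+-assoc x a b ⟩
  x ∸ (a + b)          ≤⟨ ∸-monoˡ-≤ (a + b) (≤-trans x≤ (≤-reflexive (+-assoc y a b))) ⟩
  y + (a + b) ∸ (a + b) ≡⟨ m+n∸n≡m y (a + b) ⟩
  y                    ∎
  where open ≤-Reasoning

-- Cells in decreasing lexicographic order: κ ⊒ κ′ says κ′ ≤ κ lexicographically, and
-- `sort` lists cells with every later cell ⊑ every earlier one.
Decreasing : DecTotalOrder _ _ _
Decreasing = Flip.decTotalOrder (×-decTotalOrder ≤-decTotalOrder ≤-decTotalOrder)

open DecTotalOrder Decreasing using () renaming (_≤_ to _⊒_; antisym to ⊒-antisym; totalOrder to decreasing)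
open import Data.List.Sort Decreasing using (sort; sort-↭; sort-↗)

≼⇒⊒ : ∀ {κ κ′} → κ ≼ κ′ → κ′ ⊒ κ
≼⇒⊒ {a , b} {c , d} (a≤c , b≤d) with a ≟ c
... | yes refl = inj₂ (refl , b≤d)
... | no  a≢c  = inj₁ (a≤c , a≢c)

module _ {A B : Set} (f : A → B) (_≟ᴮ_ : DecidableEquality B) (default : A) where

  preimage : List A → B → A
  preimage []       b = default
  preimage (x ∷ xs) b with f x ≟ᴮ b
  ... | yes _ = x
  ... | no  _ = preimage xs b

  preimage-∈ : ∀ xs {b} → b ∈ map f xs → preimage xs b ∈ xs × f (preimage xs b) ≡ b
  preimage-∈ (x ∷ xs) {b} b∈ with f x ≟ᴮ b
  ... | yes fx≡b = here refl , fx≡b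
  ... | no  fx≢b with b∈
  ...   | here b≡fx  = contradiction (sym b≡fx) fx≢b
  ...   | there b∈′ = let p , q = preimage-∈ xs b∈′ in there p , q

private
  split-area : ∀ b i μ n → (b + i) * μ * n ≡ b * μ * n + i * μ * n
  split-area = ℕ-Ring.solve-∀
  collect-area : ∀ n μ m q → 5 * (n * n) + 5 * (μ * μ * m) + 25 * q * μ * n + (n * n + μ * μ * m)
                             ≡ 25 * (q * μ * n) + 6 * n * n + 6 * μ * μ * m
  collect-area = ℕ-Ring.solve-∀

module Selection (n m k μ : ℕ) (fk : fib k ≡ m) (m∣n : m ∣ n) (m≥1 : 1 ≤ m) (μ≥1 : 1 ≤ μ)
                 (n≤μm : n ≤ μ * m) (μ≤n : μ ≤ n) (Q′ : List Point) (Q′⊆[n]² : All (InRange n) Q′) where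

  private
    instance
      m≢0 : NonZero m
      m≢0 = >-nonZero m≥1
      μ≢0 : NonZero μ
      μ≢0 = >-nonZero μ≥1
      n≢0 : NonZero n
      n≢0 = >-nonZero (≤-trans μ≥1 μ≤n)

  s : ℕ
  s = divℕ n m

  n≡sm : n ≡ s * m
  n≡sm = sym (trans (cong (_* m) (divℕ≡/ n m)) (m/n*n≡m m∣n))

  s≥1 : 1 ≤ s
  s≥1 = n≢0⇒n>0 (λ s≡0 → <⇒≢ (≤-trans μ≥1 μ≤n) (sym (trans n≡sm (cong (_* m) s≡0))))

  s≤μ : s ≤ μ
  s≤μ = *-cancelʳ-≤ s μ m (subst (_≤ μ * m) n≡sm n≤μm)

  open Grid n m k μ s fk n≡sm s≥1 m≥1 s≤μ μ≤n

  _≟ₚ_ : DecidableEquality Point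
  _≟ₚ_ = ≡-dec _≟_ _≟_

  cellOf : Point → Point
  cellOf = gridCell μ (n * n) (m * μ)

  cells : List Point
  cells = deduplicate _≟ₚ_ (map cellOf Q′)

  rep : Point → Point
  rep = preimage cellOf _≟ₚ_ (0 , 0) Q′

  rep-∈ : ∀ {κ} → κ ∈ cells → rep κ ∈ Q′ × cellOf (rep κ) ≡ κ
  rep-∈ κ∈cells = preimage-∈ cellOf _≟ₚ_ (0 , 0) Q′ (∈-deduplicate⁻ _≟ₚ_ (map cellOf Q′) κ∈cells)

  leftCells lowerCells interior : List Point
  leftCells  = filter (λ κ → proj₁ κ <? 4) cells
  lowerCells = filter (λ κ → proj₂ κ <? 4) (filter (∁? (λ κ → proj₁ κ <? 4)) cells)
  interior   = filter (∁? (λ κ → proj₂ κ <? 4)) (filter (∁? (λ κ → proj₁ κ <? 4)) cells)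

  residue : Point → Point
  residue (c , r) = (c % 5 , r % 5)

  open Classes residue _≟ₚ_ using (count; pigeonhole)

  majority : ∃ λ t → length interior ≤ 25 * count t interior
  majority = pigeonhole (0 , 0) _ interior (All.tabulate (λ {κ} _ → ∈-cartesianProduct⁺ (∈-upTo⁺ (m%n<n (proj₁ κ) 5)) (∈-upTo⁺ (m%n<n (proj₂ κ) 5))))

  t : Point
  t = proj₁ majority

  chosen ordered : List Point
  chosen  = filter (λ κ → residue κ ≟ₚ t) interior
  ordered = sort chosen

  Q : List Point
  Q = map rep ordered

  Chosen : Point → Set
  Chosen κ = κ ∈ cells × 4 ≤ proj₁ κ × 4 ≤ proj₂ κ × residue κ ≡ t

  ordered-chosen : All Chosen ordered
  ordered-chosen = All.tabulate λ κ∈ordered →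
    let κ∈interior , residue≡t = ∈-filter⁻ (λ κ → residue κ ≟ₚ t) (∈-resp-↭ (sort-↭ chosen) κ∈ordered)
        κ∈inner , row≮4        = ∈-filter⁻ (∁? (λ κ → proj₂ κ <? 4)) κ∈interior
        κ∈cells , col≮4        = ∈-filter⁻ (∁? (λ κ → proj₁ κ <? 4)) κ∈inner
    in κ∈cells , ≮⇒≥ col≮4 , ≮⇒≥ row≮4 , residue≡t

  cells-unique : Unique cells
  cells-unique = deduplicate-! (map cellOf Q′)

  ordered-unique : Unique ordered
  ordered-unique = Permutationₛ.Unique-resp-↭ (setoid Point) (↭⇒↭ₛ (↭-sym (sort-↭ chosen)))
    (Unique.filter⁺ _ (Unique.filter⁺ _ (Unique.filter⁺ _ cells-unique)))

  ordered-decreasing : AllPairs _⊒_ ordered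
  ordered-decreasing = Sorted⇒AllPairs decreasing (sort-↗ chosen)

  pivot : ∀ {κ} → Chosen κ → ∃ λ j → j < m × latticePt n m k j ≼ rep κ ×
    (∀ x′ y′ → latticePt n m k j ≼ (x′ , y′) → proj₁ κ ≤ col x′ + 4 × proj₂ κ ≤ row y′ + 4)
  pivot {κ} (κ∈cells , 4≤c , 4≤r , _) =
    let q∈Q′ , cell≡κ = rep-∈ κ∈cells
        x<n , y<n = All.lookup Q′⊆[n]² q∈Q′
        j , j<m , Pj≼q , near = anchor (proj₁ (rep κ)) (proj₂ (rep κ)) x<n y<n
                                  (subst (4 ≤_) (sym (cong proj₁ cell≡κ)) 4≤c) (subst (4 ≤_) (sym (cong proj₂ cell≡κ)) 4≤r)
    in j , j<m , Pj≼q , λ x′ y′ Pj≼q′ → let c≤ , r≤ = near x′ y′ Pj≼q′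
                                        in subst (_≤ col x′ + 4) (cong proj₁ cell≡κ) c≤ , subst (_≤ row y′ + 4) (cong proj₂ cell≡κ) r≤

  -- If the representative of another chosen cell κ′ dominates the pivot of κ, then κ ≼ κ′:
  -- the cells are at most four apart in each coordinate and congruent modulo 5.
  pivot-separates : ∀ {κ κ′} (c : Chosen κ) → Chosen κ′ → latticePt n m k (proj₁ (pivot c)) ≼ rep κ′ → κ ≼ κ′
  pivot-separates {κ} {κ′} c c′@(κ′∈cells , _ , _ , residue′≡t) Pj≼q′ =
    let cell≡κ′ = proj₂ (rep-∈ κ′∈cells)
        c≤ , r≤ = proj₂ (proj₂ (proj₂ (pivot c))) (proj₁ (rep κ′)) (proj₂ (rep κ′)) Pj≼q′
        same = trans (proj₂ (proj₂ (proj₂ c))) (sym residue′≡t)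
    in close (proj₁ κ) (proj₁ κ′) (subst (λ z → proj₁ κ ≤ z + 4) (cong proj₁ cell≡κ′) c≤) (cong proj₁ same)
     , close (proj₂ κ) (proj₂ κ′) (subst (λ z → proj₂ κ ≤ z + 4) (cong proj₂ cell≡κ′) r≤) (cong proj₂ same)
    where
    close : ∀ a b → a ≤ b + 4 → a % 5 ≡ b % 5 → a ≤ b
    close a b a≤b+4 = congruent-≤ 5 a b (≤-trans (s≤s a≤b+4) (≤-reflexive (sym (+-suc b 4))))

  -- Listing chosen cells in decreasing order makes the incidence vectors of their
  -- representatives triangular: a later cell κ′ ⊑ κ dominating κ's pivot would give κ ≼ κ′.
  triangular : ∀ L → AllPairs _⊒_ L → Unique L → All Chosen L → Triangular m (map (inc n m k) (map rep L))
  triangular []      _                 _              _              = []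
  triangular (κ ∷ L) (κ⊒L ∷ decreasing) (κ∉L ∷ unique) (c ∷ chosenL) =
    let j , j<m , Pj≼q , _ = pivot c
        vanish : All (λ κ′ → inc n m k (rep κ′) j ≡ 0) L
        vanish = All.tabulate λ {κ′} κ′∈L → domInd-⋠ _ _ λ Pj≼q′ →
          All.lookup κ∉L κ′∈L (sym (≡×≡⇒≡ (⊒-antisym (All.lookup κ⊒L κ′∈L)
            (≼⇒⊒ (pivot-separates c (All.lookup chosenL κ′∈L) Pj≼q′)))))
    in (j , j<m , domInd-≼ _ _ Pj≼q , map⁺ (map⁺ vanish)) ∷ triangular L decreasing unique chosenL

  Q-independent : ∀ {Δ} → LinIndep Δ m (map (inc n m k) Q)
  Q-independent = triangular⇒independent (triangular ordered ordered-decreasing ordered-unique ordered-chosen)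

  Q⊆Q′ : ∀ {q} → q ∈ Q → q ∈ Q′
  Q⊆Q′ q∈Q = let κ , κ∈ordered , q≡rep = ∈-map⁻ rep q∈Q
              in subst (_∈ Q′) (sym q≡rep) (proj₁ (rep-∈ (proj₁ (All.lookup ordered-chosen κ∈ordered))))

  -- Q has one query per chosen cell, so it is duplicate-free.
  Q-unique : Unique Q
  Q-unique = Unique.map⁻ (subst Unique (sym cells-of-Q) ordered-unique)
    where
    cells-of-Q : map cellOf Q ≡ ordered
    cells-of-Q = trans (sym (map-∘ ordered))
                   (trans (map-cong-local (All.map (λ c → proj₂ (rep-∈ (proj₁ c))) ordered-chosen)) (map-id ordered))

  private
    C-ceiling : ∃ λ C → (∀ r → r * μ < n → r < C) × C * μ < n + μ
    C-ceiling = ceiling n μ (≤-trans μ≥1 μ≤n)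
    R-ceiling : ∃ λ R → (∀ r → r * n < m * μ → r < R) × R * n < m * μ + n
    R-ceiling = ceiling (m * μ) n (*-mono-≤ m≥1 μ≥1)

  C R : ℕ
  C = proj₁ C-ceiling
  R = proj₁ R-ceiling

  inBox : ∀ {κ} → κ ∈ cells → proj₁ κ < C × proj₂ κ < R
  inBox κ∈cells =
    let q∈Q′ , cell≡κ = rep-∈ κ∈cells
        x<n , y<n = All.lookup Q′⊆[n]² q∈Q′
    in subst (_< C) (cong proj₁ cell≡κ) (proj₁ (proj₂ C-ceiling) _ (col-bound x<n))
     , subst (_< R) (cong proj₂ cell≡κ) (proj₁ (proj₂ R-ceiling) _ (row-bound y<n))

  boundary : ℕ
  boundary = length leftCells + length lowerCells

  hits-split : length cells ≡ boundary + length interior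
  hits-split = trans (length-split _ cells) (trans (cong (length leftCells +_) (length-split _ (filter (∁? (λ κ → proj₁ κ <? 4)) cells)))
                 (sym (+-assoc (length leftCells) _ _)))

  boundary≤4R+4C : boundary ≤ 4 * R + 4 * C
  boundary≤4R+4C = +-mono-≤
    (boxCount leftCells 4 R (Unique.filter⁺ _ cells-unique) (All.tabulate λ κ∈ →
      let κ∈cells , c<4 = ∈-filter⁻ (λ κ → proj₁ κ <? 4) κ∈ in c<4 , proj₂ (inBox κ∈cells)))
    (≤-trans (boxCount lowerCells C 4 (Unique.filter⁺ _ (Unique.filter⁺ _ cells-unique)) (All.tabulate λ κ∈ →
      let κ∈inner , r<4 = ∈-filter⁻ (λ κ → proj₂ κ <? 4) κ∈
          κ∈cells , _   = ∈-filter⁻ (∁? (λ κ → proj₁ κ <? 4)) κ∈inner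
      in proj₁ (inBox κ∈cells) , r<4)) (≤-reflexive (*-comm C 4)))

  boundary≤CR : boundary ≤ C * R
  boundary≤CR = ≤-trans (≤-trans (m≤m+n boundary (length interior)) (≤-reflexive (sym hits-split)))
                  (boxCount cells C R cells-unique (All.tabulate inBox))

  -- Q has one query per chosen cell, and the chosen class is a 1/25 share of the interior.
  interior≤25Q : length interior ≤ 25 * length Q
  interior≤25Q = subst (λ l → length interior ≤ 25 * l) (sym (trans (length-map rep ordered) (↭-length (sort-↭ chosen)))) (proj₂ majority)

  -- h μ n ≤ 25 |Q| μ n + 6 n² + 6 μ² m: the boundary cells are paid for by the
  -- additive terms, the interior cells by 25 |Q|.
  hitting-bound : length cells * μ * n ≤ 25 * (length Q * μ * n) + 6 * n * n + 6 * μ * μ * m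
  hitting-bound = begin
    length cells * μ * n
      ≡⟨ cong (λ h → h * μ * n) hits-split ⟩
    (boundary + length interior) * μ * n
      ≡⟨ split-area boundary (length interior) μ n ⟩
    boundary * μ * n + length interior * μ * n
      ≤⟨ +-mono-≤ (boundaryArea n μ m C R boundary boundary≤CR boundary≤4R+4C (proj₂ (proj₂ C-ceiling)) (proj₂ (proj₂ R-ceiling)) μ≤n n≤μm)
                  (*-monoˡ-≤ n (*-monoˡ-≤ μ interior≤25Q)) ⟩
    5 * (n * n) + 5 * (μ * μ * m) + 25 * length Q * μ * n
      ≤⟨ m≤m+n _ (n * n + μ * μ * m) ⟩
    5 * (n * n) + 5 * (μ * μ * m) + 25 * length Q * μ * n + (n * n + μ * μ * m)
      ≡⟨ collect-area n μ m (length Q) ⟩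
    25 * (length Q * μ * n) + 6 * n * n + 6 * μ * μ * m ∎
    where open ≤-Reasoning

lemma7 : ∃₂ λ (a b : ℕ) → 0 < a × 0 < b ×
    ((n β i Δ k μ : ℕ) → 1 < β → 1 ≤ i → fib k ≡ β ^ i → β ^ i ∣ n → Prime Δ →
     1 ≤ μ → n ≤ μ * β ^ i → μ ≤ n →
     (Q′ : List Point) → Unique Q′ → All (InRange n) Q′ →
     ∃ λ (Q : List Point) → Unique Q × (∀ {q} → q ∈ Q → q ∈ Q′) ×
       LinIndep Δ (β ^ i) (map (inc n (β ^ i) k) Q) ×
       a * (hittingNumber μ (n * n) (β ^ i * μ) Q′ * μ * n ∸ 6 * n * n ∸ 6 * μ * μ * β ^ i)
         ≤ b * (length Q * μ * n))
lemma7 = 1 , 25 , s≤s z≤n , s≤s z≤n ,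
  λ n β i Δ k μ β>1 _ fk βⁱ∣n _ μ≥1 n≤μβⁱ μ≤n Q′ _ Q′⊆[n]² →
    let open Selection n (β ^ i) k μ fk βⁱ∣n (m^n>0 β {{>-nonZero (<⇒≤ β>1)}} i) μ≥1 n≤μβⁱ μ≤n Q′ Q′⊆[n]²
    in Q , Q-unique , Q⊆Q′ , Q-independent ,
       ≤-trans (≤-reflexive (*-identityˡ _)) (∸∸-≤ _ _ _ _ hitting-bound)
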